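{- Let $X$ be a set of $n$ cards, let $a,b,c$ be positive integers with $a+b+c=n$ and $a>c$, and put $t=a-c$. (i) If $(X,\mathcal{A}_1),\dots,(X,\mathcal{A}_N)$ is a large set of $t$-$(n,a,1)$-designs, then taking $\mathcal{A}_1,\dots,\mathcal{A}_N$ as announcements (each $a$-subset lies in exactly one, so the strategy is deterministic) gives an $(a,b,c)$-strategy that is informative for Bob and has exactly $N=\binom{n-a+c}{c}$ announcements. (ii) Conversely, if an $(a,b,c)$-strategy with $m=\binom{n-a+c}{c}$ announcements $\mathcal{A}_1,\dots,\mathcal{A}_m$ is informative for Bob, then every $(X,\mathcal{A}_i)$ is a $t$-$(n,a,1)$-design and $(X,\mathcal{A}_1),\dots,(X,\mathcal{A}_m)$ form a large set of $t$-$(n,a,1)$-designs. (Thus optimal informative strategies, i.e. those with $m=\binom{n-a+c}{c}$, are equivalent to large sets of $t$-$(n,a,1)$-designs.)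
   Context: An $(a,b,c)$-deal partitions $X$ into Alice's hand $H_A$ ($a$ cards), Bob's hand $H_B$ ($b$ cards) and Cathy's hand $H_C$ ($c$ cards). $\binom{X}{t}$ denotes the set of $t$-subsets of $X$. An announcement is a subset of $\binom{X}{a}$. An $(a,b,c)$-strategy consists of announcements $\mathcal{A}_1,\dots,\mathcal{A}_m$ such that every $a$-subset of $X$ lies in at least one $\mathcal{A}_i$, together with, for each $H_A$, a probability distribution $p_{H_A}$ with positive values on $g(H_A)=\{i : H_A\in\mathcal{A}_i\}$; Alice holding $H_A$ broadcasts an index $i$ chosen according to $p_{H_A}$. For $H\subseteq X$, $\mathcal{P}(H,i)=\{H_A\in\mathcal{A}_i : H_A\cap H=\emptyset\}$; the strategy is informative for Bob if $|\mathcal{P}(H_B,i)|\le1$ for all $H_B\in\binom{X}{b}$ and all $i$. A $t$-$(v,k,\lambda)$-design ($t\le k<v$ positive integers) is a pair $(X,\mathcal{B})$ with $|X|=v$ and $\mathcal{B}$ a multiset of $k$-subsets (blocks) such that every $t$-subset of $X$ lies in exactly $\lambda$ blocks. A large set of $t$-$(v,k,1)$-designs is a collection of $t$-$(v,k,1)$-designs on the same point set $X$ such that every $k$-subset of $X$ is a block of exactly one of them; it necessarily contains $\binom{v-t}{k-t}$ designs.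
   Formalization: In part (ii), the probability distributions $p_{H_A}$ of the given informative strategy take rational values. -}

module Defs where

open import Data.Bool using (Bool; true; false; _∧_; not; if_then_else_)
open import Data.Nat using (ℕ; zero; suc; _+_; _≤_; _<_)
open import Data.Vec using (Vec; []; _∷_)
open import Data.Fin using (Fin)
open import Data.Fin.Subset using (Subset; ∣_∣; inside; outside)
open import Data.List using (List; foldr; map; allFin)
open import Data.Product using (_×_; Σ; ∃)
open import Relation.Binary.PropositionalEquality using (_≡_)
import Data.Rational as ℚ
open ℚ using (ℚ)

-- The card set X is Fin n; subsets of X are 'Subset n'.
-- A family of subsets of X (an announcement, or the block set of a design)
-- is represented by its (decidable) characteristic function.
Family : ℕ → Set
Family n = Subset n → Bool

countS : ∀ {n} → (Subset n → Bool) → ℕ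
countS {zero}  f = if f [] then 1 else 0
countS {suc n} f = countS (λ s → f (outside ∷ s)) + countS (λ s → f (inside ∷ s))

countFin : ∀ {m} → (Fin m → Bool) → ℕ
countFin {m} f = foldr (λ i r → if f i then suc r else r) 0 (allFin m)

disjointᵇ : ∀ {n} → Subset n → Subset n → Bool
disjointᵇ [] [] = true
disjointᵇ (x ∷ xs) (y ∷ ys) = not (x ∧ y) ∧ disjointᵇ xs ys

⊆ᵇ : ∀ {n} → Subset n → Subset n → Bool
⊆ᵇ [] [] = true
⊆ᵇ (x ∷ xs) (y ∷ ys) = (not x ∨' y) ∧ ⊆ᵇ xs ys
  where
  _∨'_ : Bool → Bool → Bool
  true ∨' _ = true
  false ∨' b = b

sumℚ : ∀ {m} → (Fin m → ℚ) → ℚ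
sumℚ {m} f = foldr (λ i r → f i ℚ.+ r) ℚ.0ℚ (allFin m)

IsDesign : (t v k λ' : ℕ) → Family v → Set
IsDesign t v k λ' B =
  (1 ≤ t) × (t ≤ k) × (k < v)
  × (∀ K → B K ≡ true → ∣ K ∣ ≡ k)
  × (∀ T → ∣ T ∣ ≡ t → countS (λ K → B K ∧ ⊆ᵇ T K) ≡ λ')

IsLargeSet : (t v k N : ℕ) → (Fin N → Family v) → Set
IsLargeSet t v k N D =
  (∀ i → IsDesign t v k 1 (D i))
  × (∀ K → ∣ K ∣ ≡ k → countFin (λ i → D i K) ≡ 1)

-- An (a,b,c)-strategy on X = Fin n with announcements A_1..A_m and, for each
-- hand H_A, a probability distribution p H_A on the indices, positive exactly on
-- g(H_A) = {i : H_A ∈ A_i} (and zero outside it).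
IsStrategy : (n a m : ℕ) → (Fin m → Family n) → (Subset n → Fin m → ℚ) → Set
IsStrategy n a m A p =
  (∀ i H → A i H ≡ true → ∣ H ∣ ≡ a)
  × (∀ H → ∣ H ∣ ≡ a → ∃ λ i → A i H ≡ true)
  × (∀ H → ∣ H ∣ ≡ a →
       (∀ i → (A i H ≡ true → ℚ.0ℚ ℚ.< p H i) × (A i H ≡ false → p H i ≡ ℚ.0ℚ))
       × sumℚ (p H) ≡ ℚ.1ℚ)

InformativeForBob : (n b m : ℕ) → (Fin m → Family n) → Set
InformativeForBob n b m A =
  ∀ HB → ∣ HB ∣ ≡ b → ∀ i → countS (λ H → A i H ∧ disjointᵇ H HB) ≤ 1

module Submission where

-- Put t = a − c, so that n + t = b + 2a. Two a-sets K, L avoid a common b-set iff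
-- |K ∪ L| ≤ n − b, i.e. iff |K ∩ L| ≥ t, i.e. iff they share a t-set. Hence an
-- announcement is informative for Bob exactly when no t-set lies in two of its hands.
-- Double counting pairs (t-set ⊆ hand) bounds such a packing by |Aᵢ|·C(a,t) ≤ C(n,t),
-- while covering all a-sets gives Σ|Aᵢ| ≥ C(n,a). As C(n,a)·C(a,t) = C(n,t)·C(n−t,a−t),
-- with m = C(n−t,a−t) announcements every inequality is tight: each Aᵢ is a
-- t-(n,a,1) design and each a-set lies in exactly one Aᵢ. Conversely the designs of a
-- large set are packings, and the same count determines their number.

open import Defs
open import Data.Nat using (ℕ; zero; suc; _+_; _*_; _∸_; _≤_; _<_; z≤n; s≤s; s≤s⁻¹; _≤?_; _≡ᵇ_; _!; NonZero)
open import Data.Nat.Combinatorics using (_C_; nCk+nC[k+1]≡[n+1]C[k+1]; nCk≡n!/k![n-k]!; k![n∸k]!∣n!)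
open import Data.Nat.DivMod using (m/n*n≡m)
open import Data.Nat.Tactic.RingSolver using (solve-∀)
open import Data.Nat.Properties
open import Data.Bool using (Bool; true; false; _∧_; if_then_else_)
open import Data.Bool.Properties using (∧-zeroʳ; T-≡)
open import Data.Vec using (_∷_; [])
open import Data.Vec.Properties using (∷-injectiveʳ)
open import Data.Fin using (Fin)
open import Data.Fin.Subset using (Subset; ∣_∣; inside; outside; _∪_; _∩_; ⊤)
open import Data.Fin.Subset.Properties using (∣p∣≤n; ∣⊤∣≡n)
open import Data.List using (List; []; _∷_; _++_; map; foldr; length; allFin)
open import Data.List.Properties using (length-tabulate)
open import Data.List.Membership.Propositional using (_∈_)
open import Data.List.Membership.Propositional.Properties using (∈-++⁺ˡ; ∈-++⁺ʳ; ∈-map⁺; ∈-allFin)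
open import Data.List.Relation.Unary.Any using (here; there)
open import Data.Product using (_×_; Σ; ∃; _,_; proj₁; proj₂)
open import Data.Rational using (ℚ; 0ℚ; 1ℚ) renaming (_+_ to _+ℚ_; _<_ to _<ℚ_)
import Data.Rational.Properties as ℚ
open import Data.Empty using (⊥-elim)
open import Function using (_∘_; id; Equivalence)
open import Relation.Nullary using (¬_; yes; no)
open import Relation.Binary.PropositionalEquality using (_≡_; refl; sym; trans; cong; cong₂; subst; subst₂; module ≡-Reasoning)
import Algebra.Properties.CommutativeSemigroup
module +-CS = Algebra.Properties.CommutativeSemigroup +-commutativeSemigroup
module *-CS = Algebra.Properties.CommutativeSemigroup *-commutativeSemigroup

χ : Bool → ℕ
χ true = 1
χ false = 0

∧≡true⇒ : ∀ {x y} → x ∧ y ≡ true → x ≡ true × y ≡ true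
∧≡true⇒ {true} y≡true = refl , y≡true

χ-∧ : ∀ x y → χ (x ∧ y) ≡ χ x * χ y
χ-∧ true  y = sym (+-identityʳ (χ y))
χ-∧ false y = refl

≡ᵇ-true⇒≡ : ∀ {m k} → (m ≡ᵇ k) ≡ true → m ≡ k
≡ᵇ-true⇒≡ {m} {k} m≡ᵇk = ≡ᵇ⇒≡ m k (Equivalence.from T-≡ m≡ᵇk)

≡⇒≡ᵇ-true : ∀ {m k} → m ≡ k → (m ≡ᵇ k) ≡ true
≡⇒≡ᵇ-true {m} {k} m≡k = Equivalence.to T-≡ (≡⇒≡ᵇ m k m≡k)

private variable I J : Set

∑ : List I → (I → ℕ) → ℕ
∑ xs f = foldr (λ x r → f x + r) 0 xs

infixr 6.5 ∑
syntax ∑ xs (λ x → e) = ∑[ x ∈ xs ] e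

∑-cong : ∀ {f g : I → ℕ} xs → (∀ x → f x ≡ g x) → ∑ xs f ≡ ∑ xs g
∑-cong []       f≗g = refl
∑-cong (x ∷ xs) f≗g = cong₂ _+_ (f≗g x) (∑-cong xs f≗g)

∑-mono-≤ : ∀ {f g : I → ℕ} xs → (∀ x → f x ≤ g x) → ∑ xs f ≤ ∑ xs g
∑-mono-≤ []       f≤g = z≤n
∑-mono-≤ (x ∷ xs) f≤g = +-mono-≤ (f≤g x) (∑-mono-≤ xs f≤g)

∑-++ : ∀ (f : I → ℕ) xs ys → ∑ (xs ++ ys) f ≡ ∑ xs f + ∑ ys f
∑-++ f []       ys = refl
∑-++ f (x ∷ xs) ys = trans (cong (f x +_) (∑-++ f xs ys)) (sym (+-assoc (f x) _ _))

∑-map : ∀ (f : I → ℕ) (h : J → I) xs → ∑ (map h xs) f ≡ ∑ xs (f ∘ h)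
∑-map f h []       = refl
∑-map f h (x ∷ xs) = cong (f (h x) +_) (∑-map f h xs)

∑-const : ∀ k (xs : List I) → ∑[ x ∈ xs ] k ≡ length xs * k
∑-const k []       = refl
∑-const k (x ∷ xs) = cong (k +_) (∑-const k xs)

∑-distrib-+ : ∀ (f g : I → ℕ) xs → ∑[ x ∈ xs ] (f x + g x) ≡ ∑ xs f + ∑ xs g
∑-distrib-+ f g []       = refl
∑-distrib-+ f g (x ∷ xs) = trans (cong (f x + g x +_) (∑-distrib-+ f g xs))
                                 (+-CS.interchange (f x) (g x) _ _)

∑-zero : ∀ (xs : List I) → ∑[ x ∈ xs ] 0 ≡ 0
∑-zero xs = trans (∑-const 0 xs) (*-zeroʳ (length xs))

∑-comm : ∀ (f : I → J → ℕ) xs ys →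
         ∑[ x ∈ xs ] ∑[ y ∈ ys ] f x y ≡ ∑[ y ∈ ys ] ∑[ x ∈ xs ] f x y
∑-comm f []       ys = sym (∑-zero ys)
∑-comm f (x ∷ xs) ys = trans (cong (∑ ys (f x) +_) (∑-comm f xs ys))
                             (sym (∑-distrib-+ (f x) _ ys))

*-distribˡ-∑ : ∀ k (f : I → ℕ) xs → k * ∑ xs f ≡ ∑[ x ∈ xs ] (k * f x)
*-distribˡ-∑ k f []       = *-zeroʳ k
*-distribˡ-∑ k f (x ∷ xs) = trans (*-distribˡ-+ k (f x) _) (cong (k * f x +_) (*-distribˡ-∑ k f xs))

∈⇒≤∑ : ∀ (f : I → ℕ) {x xs} → x ∈ xs → f x ≤ ∑ xs f
∈⇒≤∑ f (here refl)         = m≤m+n _ _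
∈⇒≤∑ f {xs = y ∷ _} (there x∈xs) = ≤-trans (∈⇒≤∑ f x∈xs) (m≤n+m _ (f y))

∑-mono-≤-tight : ∀ {f g : I → ℕ} xs → (∀ x → f x ≤ g x) → ∑ xs g ≤ ∑ xs f →
                 ∀ {x} → x ∈ xs → f x ≡ g x
∑-mono-≤-tight {f = f} {g = g} (y ∷ ys) f≤g ∑g≤∑f x∈xs = go x∈xs
  where
  gy≤fy : g y ≤ f y
  gy≤fy = +-cancelʳ-≤ (∑ ys f) (g y) (f y)
            (≤-trans (+-monoʳ-≤ (g y) (∑-mono-≤ ys f≤g)) ∑g≤∑f)
  tail-tight : ∑ ys g ≤ ∑ ys f
  tail-tight = +-cancelˡ-≤ (g y) (∑ ys g) (∑ ys f)
                 (≤-trans ∑g≤∑f (+-monoˡ-≤ (∑ ys f) (f≤g y)))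
  go : ∀ {x} → x ∈ y ∷ ys → f x ≡ g x
  go (here refl)  = ≤-antisym (f≤g y) gy≤fy
  go (there x∈ys) = ∑-mono-≤-tight ys f≤g tail-tight x∈ys

∑χ-witness : ∀ (f : I → Bool) xs → 1 ≤ ∑[ x ∈ xs ] χ (f x) → ∃ λ x → f x ≡ true
∑χ-witness f (x ∷ xs) 1≤∑ with f x in fx
... | true  = x , fx
... | false = ∑χ-witness f xs 1≤∑

subsets : ∀ n → List (Subset n)
subsets zero    = [] ∷ []
subsets (suc n) = map (outside ∷_) (subsets n) ++ map (inside ∷_) (subsets n)

∈-subsets : ∀ {n} (s : Subset n) → s ∈ subsets n
∈-subsets []            = here refl
∈-subsets (outside ∷ s) = ∈-++⁺ˡ (∈-map⁺ (outside ∷_) (∈-subsets s))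
∈-subsets (inside ∷ s)  = ∈-++⁺ʳ _ (∈-map⁺ (inside ∷_) (∈-subsets s))

countS≡∑χ : ∀ {n} (f : Subset n → Bool) → countS f ≡ ∑[ s ∈ subsets n ] χ (f s)
countS≡∑χ {zero} f with f []
... | true  = refl
... | false = refl
countS≡∑χ {suc n} f = begin
  countS (f ∘ (outside ∷_)) + countS (f ∘ (inside ∷_))
    ≡⟨ cong₂ _+_ (countS≡∑χ (f ∘ (outside ∷_))) (countS≡∑χ (f ∘ (inside ∷_))) ⟩
  ∑[ s ∈ subsets n ] χ (f (outside ∷ s)) + ∑[ s ∈ subsets n ] χ (f (inside ∷ s))
    ≡⟨ cong₂ _+_ (∑-map (χ ∘ f) (outside ∷_) (subsets n)) (∑-map (χ ∘ f) (inside ∷_) (subsets n)) ⟨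
  ∑ (map (outside ∷_) (subsets n)) (χ ∘ f) + ∑ (map (inside ∷_) (subsets n)) (χ ∘ f)
    ≡⟨ ∑-++ (χ ∘ f) (map (outside ∷_) (subsets n)) _ ⟨
  ∑[ s ∈ subsets (suc n) ] χ (f s) ∎
  where open ≡-Reasoning

countS-cong : ∀ {n} {f g : Subset n → Bool} → (∀ s → f s ≡ g s) → countS f ≡ countS g
countS-cong {f = f} {g} f≗g = begin
  countS f                           ≡⟨ countS≡∑χ f ⟩
  ∑[ s ∈ subsets _ ] χ (f s)         ≡⟨ ∑-cong (subsets _) (cong χ ∘ f≗g) ⟩
  ∑[ s ∈ subsets _ ] χ (g s)         ≡⟨ countS≡∑χ g ⟨
  countS g                           ∎
  where open ≡-Reasoning

countS-false : ∀ n → countS {n} (λ _ → false) ≡ 0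
countS-false n = trans (countS≡∑χ {n} (λ _ → false)) (∑-zero (subsets n))

true⇒1≤countS : ∀ {n} (f : Subset n → Bool) {s} → f s ≡ true → 1 ≤ countS f
true⇒1≤countS f {s} fs = subst (1 ≤_) (sym (countS≡∑χ f))
  (subst (λ b → χ b ≤ ∑[ s ∈ subsets _ ] χ (f s)) fs (∈⇒≤∑ (χ ∘ f) (∈-subsets s)))

AtMostOne : ∀ {n} → (Subset n → Bool) → Set
AtMostOne f = ∀ {x y} → f x ≡ true → f y ≡ true → x ≡ y

countS≤1⇒AtMostOne : ∀ {n} (f : Subset n → Bool) → countS f ≤ 1 → AtMostOne f
countS≤1⇒AtMostOne {zero} f _ {[]} {[]} _ _ = refl
countS≤1⇒AtMostOne {suc n} f ≤1 {outside ∷ x} {outside ∷ y} fx fy =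
  cong (outside ∷_) (countS≤1⇒AtMostOne (f ∘ (outside ∷_)) (≤-trans (m≤m+n _ _) ≤1) fx fy)
countS≤1⇒AtMostOne {suc n} f ≤1 {inside ∷ x} {inside ∷ y} fx fy =
  cong (inside ∷_) (countS≤1⇒AtMostOne (f ∘ (inside ∷_)) (≤-trans (m≤n+m _ _) ≤1) fx fy)
countS≤1⇒AtMostOne {suc n} f ≤1 {outside ∷ x} {inside ∷ y} fx fy =
  ⊥-elim (<-irrefl refl (≤-trans (+-mono-≤ (true⇒1≤countS (f ∘ (outside ∷_)) fx)
                                            (true⇒1≤countS (f ∘ (inside ∷_)) fy)) ≤1))
countS≤1⇒AtMostOne {suc n} f ≤1 {inside ∷ x} {outside ∷ y} fx fy =
  ⊥-elim (<-irrefl refl (≤-trans (+-mono-≤ (true⇒1≤countS (f ∘ (outside ∷_)) fy)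
                                            (true⇒1≤countS (f ∘ (inside ∷_)) fx)) ≤1))

countS-witness : ∀ {n} (f : Subset n → Bool) → 1 ≤ countS f → ∃ λ s → f s ≡ true
countS-witness f 1≤count = ∑χ-witness f (subsets _) (subst (1 ≤_) (countS≡∑χ f) 1≤count)

AtMostOne⇒countS≤1 : ∀ {n} (f : Subset n → Bool) → AtMostOne f → countS f ≤ 1
AtMostOne⇒countS≤1 {zero} f _ with f []
... | true  = ≤-refl
... | false = z≤n
AtMostOne⇒countS≤1 {suc n} f unique
  with 1 ≤? countS (f ∘ (outside ∷_)) | 1 ≤? countS (f ∘ (inside ∷_))
... | yes l | yes r =
  ⊥-elim (outside∷≢inside∷ (unique (proj₂ (countS-witness (f ∘ (outside ∷_)) l))
                                   (proj₂ (countS-witness (f ∘ (inside ∷_)) r))))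
  where outside∷≢inside∷ : ∀ {x y : Subset n} → ¬ outside ∷ x ≡ inside ∷ y
        outside∷≢inside∷ ()
... | yes _ | no r  = +-mono-≤ (AtMostOne⇒countS≤1 _ λ p q → ∷-injectiveʳ (unique p q)) (s≤s⁻¹ (≰⇒> r))
... | no l  | _     = +-mono-≤ (s≤s⁻¹ (≰⇒> l)) (AtMostOne⇒countS≤1 _ λ p q → ∷-injectiveʳ (unique p q))

∣p∪q∣+∣p∩q∣≡∣p∣+∣q∣ : ∀ {n} (p q : Subset n) → ∣ p ∪ q ∣ + ∣ p ∩ q ∣ ≡ ∣ p ∣ + ∣ q ∣
∣p∪q∣+∣p∩q∣≡∣p∣+∣q∣ []            []            = refl
∣p∪q∣+∣p∩q∣≡∣p∣+∣q∣ (outside ∷ p) (outside ∷ q) = ∣p∪q∣+∣p∩q∣≡∣p∣+∣q∣ p q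
∣p∪q∣+∣p∩q∣≡∣p∣+∣q∣ (inside ∷ p)  (outside ∷ q) = cong suc (∣p∪q∣+∣p∩q∣≡∣p∣+∣q∣ p q)
∣p∪q∣+∣p∩q∣≡∣p∣+∣q∣ (outside ∷ p) (inside ∷ q)  =
  trans (cong suc (∣p∪q∣+∣p∩q∣≡∣p∣+∣q∣ p q)) (sym (+-suc ∣ p ∣ ∣ q ∣))
∣p∪q∣+∣p∩q∣≡∣p∣+∣q∣ (inside ∷ p)  (inside ∷ q)  = cong suc (begin
  ∣ p ∪ q ∣ + suc ∣ p ∩ q ∣  ≡⟨ +-suc ∣ p ∪ q ∣ ∣ p ∩ q ∣ ⟩
  suc (∣ p ∪ q ∣ + ∣ p ∩ q ∣) ≡⟨ cong suc (∣p∪q∣+∣p∩q∣≡∣p∣+∣q∣ p q) ⟩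
  suc (∣ p ∣ + ∣ q ∣)        ≡⟨ +-suc ∣ p ∣ ∣ q ∣ ⟨
  ∣ p ∣ + suc ∣ q ∣          ∎)
  where open ≡-Reasoning

⊆ᵇ⇒∣p∣≤∣q∣ : ∀ {n} (p q : Subset n) → ⊆ᵇ p q ≡ true → ∣ p ∣ ≤ ∣ q ∣
⊆ᵇ⇒∣p∣≤∣q∣ []            []            _   = z≤n
⊆ᵇ⇒∣p∣≤∣q∣ (outside ∷ p) (outside ∷ q) p⊆q = ⊆ᵇ⇒∣p∣≤∣q∣ p q p⊆q
⊆ᵇ⇒∣p∣≤∣q∣ (outside ∷ p) (inside ∷ q)  p⊆q = m≤n⇒m≤1+n (⊆ᵇ⇒∣p∣≤∣q∣ p q p⊆q)
⊆ᵇ⇒∣p∣≤∣q∣ (inside ∷ p)  (inside ∷ q)  p⊆q = s≤s (⊆ᵇ⇒∣p∣≤∣q∣ p q p⊆q)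

⊆ᵇ-∩ : ∀ {n} (p q r : Subset n) → ⊆ᵇ p (q ∩ r) ≡ ⊆ᵇ p q ∧ ⊆ᵇ p r
⊆ᵇ-∩ []            []            []            = refl
⊆ᵇ-∩ (outside ∷ p) (_ ∷ q)       (_ ∷ r)       = ⊆ᵇ-∩ p q r
⊆ᵇ-∩ (inside ∷ p)  (inside ∷ q)  (inside ∷ r)  = ⊆ᵇ-∩ p q r
⊆ᵇ-∩ (inside ∷ p)  (inside ∷ q)  (outside ∷ r) = sym (∧-zeroʳ (⊆ᵇ p q))
⊆ᵇ-∩ (inside ∷ p)  (outside ∷ q) (_ ∷ r)       = refl

⊆ᵇ-⊤ : ∀ {n} (p : Subset n) → ⊆ᵇ p ⊤ ≡ true
⊆ᵇ-⊤ []            = refl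
⊆ᵇ-⊤ (outside ∷ p) = ⊆ᵇ-⊤ p
⊆ᵇ-⊤ (inside ∷ p)  = ⊆ᵇ-⊤ p

disjointᵇ-∪ : ∀ {n} (p q r : Subset n) → disjointᵇ (p ∪ q) r ≡ disjointᵇ p r ∧ disjointᵇ q r
disjointᵇ-∪ []            []            []            = refl
disjointᵇ-∪ (outside ∷ p) (outside ∷ q) (_ ∷ r)       = disjointᵇ-∪ p q r
disjointᵇ-∪ (outside ∷ p) (inside ∷ q)  (outside ∷ r) = disjointᵇ-∪ p q r
disjointᵇ-∪ (inside ∷ p)  (outside ∷ q) (outside ∷ r) = disjointᵇ-∪ p q r
disjointᵇ-∪ (inside ∷ p)  (inside ∷ q)  (outside ∷ r) = disjointᵇ-∪ p q r
disjointᵇ-∪ (inside ∷ p)  (_ ∷ q)       (inside ∷ r)  = refl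
disjointᵇ-∪ (outside ∷ p) (inside ∷ q)  (inside ∷ r)  = sym (∧-zeroʳ (disjointᵇ p r))

disjointᵇ⇒∣p∣+∣q∣≤n : ∀ {n} (p q : Subset n) → disjointᵇ p q ≡ true → ∣ p ∣ + ∣ q ∣ ≤ n
disjointᵇ⇒∣p∣+∣q∣≤n []            []            _      = z≤n
disjointᵇ⇒∣p∣+∣q∣≤n (outside ∷ p) (outside ∷ q) p∩q≡∅ = m≤n⇒m≤1+n (disjointᵇ⇒∣p∣+∣q∣≤n p q p∩q≡∅)
disjointᵇ⇒∣p∣+∣q∣≤n (inside ∷ p)  (outside ∷ q) p∩q≡∅ = s≤s (disjointᵇ⇒∣p∣+∣q∣≤n p q p∩q≡∅)
disjointᵇ⇒∣p∣+∣q∣≤n {suc n} (outside ∷ p) (inside ∷ q) p∩q≡∅ =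
  subst (_≤ suc n) (sym (+-suc ∣ p ∣ ∣ q ∣)) (s≤s (disjointᵇ⇒∣p∣+∣q∣≤n p q p∩q≡∅))

∃⊆ᵇ-of-size : ∀ {n} k (p : Subset n) → k ≤ ∣ p ∣ → ∃ λ q → ∣ q ∣ ≡ k × ⊆ᵇ q p ≡ true
∃⊆ᵇ-of-size zero    []            _         = [] , refl , refl
∃⊆ᵇ-of-size k       (outside ∷ p) k≤∣p∣     =
  let q , ∣q∣≡k , q⊆p = ∃⊆ᵇ-of-size k p k≤∣p∣ in outside ∷ q , ∣q∣≡k , q⊆p
∃⊆ᵇ-of-size zero    (inside ∷ p)  _         =
  let q , ∣q∣≡0 , q⊆p = ∃⊆ᵇ-of-size zero p z≤n in outside ∷ q , ∣q∣≡0 , q⊆p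
∃⊆ᵇ-of-size (suc k) (inside ∷ p)  (s≤s k≤∣p∣) =
  let q , ∣q∣≡k , q⊆p = ∃⊆ᵇ-of-size k p k≤∣p∣ in inside ∷ q , cong suc ∣q∣≡k , q⊆p

∃disjointᵇ-of-size : ∀ {n} k (p : Subset n) → k + ∣ p ∣ ≤ n → ∃ λ q → ∣ q ∣ ≡ k × disjointᵇ p q ≡ true
∃disjointᵇ-of-size zero    []            _ = [] , refl , refl
∃disjointᵇ-of-size {suc n} k (inside ∷ p) k+∣p∣≤n =
  let q , ∣q∣≡k , p∩q≡∅ = ∃disjointᵇ-of-size k p (s≤s⁻¹ (subst (_≤ suc n) (+-suc k ∣ p ∣) k+∣p∣≤n))
  in outside ∷ q , ∣q∣≡k , p∩q≡∅
∃disjointᵇ-of-size zero    (outside ∷ p) _ =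
  let q , ∣q∣≡0 , p∩q≡∅ = ∃disjointᵇ-of-size zero p (∣p∣≤n p) in outside ∷ q , ∣q∣≡0 , p∩q≡∅
∃disjointᵇ-of-size (suc k) (outside ∷ p) (s≤s k+∣p∣≤n) =
  let q , ∣q∣≡k , p∩q≡∅ = ∃disjointᵇ-of-size k p k+∣p∣≤n in inside ∷ q , cong suc ∣q∣≡k , p∩q≡∅

common-subset⇒common-avoider : ∀ {n} b (K L T : Subset n) → ⊆ᵇ T K ≡ true → ⊆ᵇ T L ≡ true →
  b + ∣ K ∣ + ∣ L ∣ ≤ n + ∣ T ∣ →
  ∃ λ H → ∣ H ∣ ≡ b × disjointᵇ K H ≡ true × disjointᵇ L H ≡ true
common-subset⇒common-avoider {n} b K L T T⊆K T⊆L bound =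
  let H , ∣H∣≡b , K∪L∩H≡∅ = ∃disjointᵇ-of-size b (K ∪ L) b+∣K∪L∣≤n
      K∩H≡∅ , L∩H≡∅ = ∧≡true⇒ (trans (sym (disjointᵇ-∪ K L H)) K∪L∩H≡∅)
  in H , ∣H∣≡b , K∩H≡∅ , L∩H≡∅
  where
  open ≤-Reasoning
  T⊆K∩L : ⊆ᵇ T (K ∩ L) ≡ true
  T⊆K∩L = trans (⊆ᵇ-∩ T K L) (cong₂ _∧_ T⊆K T⊆L)
  b+∣K∪L∣≤n : b + ∣ K ∪ L ∣ ≤ n
  b+∣K∪L∣≤n = +-cancelʳ-≤ ∣ T ∣ (b + ∣ K ∪ L ∣) n (begin
    b + ∣ K ∪ L ∣ + ∣ T ∣       ≤⟨ +-monoʳ-≤ (b + ∣ K ∪ L ∣) (⊆ᵇ⇒∣p∣≤∣q∣ T (K ∩ L) T⊆K∩L) ⟩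
    b + ∣ K ∪ L ∣ + ∣ K ∩ L ∣   ≡⟨ +-assoc b _ _ ⟩
    b + (∣ K ∪ L ∣ + ∣ K ∩ L ∣) ≡⟨ cong (b +_) (∣p∪q∣+∣p∩q∣≡∣p∣+∣q∣ K L) ⟩
    b + (∣ K ∣ + ∣ L ∣)         ≡⟨ +-assoc b _ _ ⟨
    b + ∣ K ∣ + ∣ L ∣           ≤⟨ bound ⟩
    n + ∣ T ∣                   ∎)

common-avoider⇒common-subset : ∀ {n} t (K L H : Subset n) → disjointᵇ K H ≡ true → disjointᵇ L H ≡ true →
  n + t ≤ ∣ H ∣ + ∣ K ∣ + ∣ L ∣ →
  ∃ λ T → ∣ T ∣ ≡ t × ⊆ᵇ T K ≡ true × ⊆ᵇ T L ≡ true
common-avoider⇒common-subset {n} t K L H K∩H≡∅ L∩H≡∅ bound =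
  let T , ∣T∣≡t , T⊆K∩L = ∃⊆ᵇ-of-size t (K ∩ L) t≤∣K∩L∣
      T⊆K , T⊆L = ∧≡true⇒ (trans (sym (⊆ᵇ-∩ T K L)) T⊆K∩L)
  in T , ∣T∣≡t , T⊆K , T⊆L
  where
  open ≤-Reasoning
  ∣H∣+∣K∪L∣≤n : ∣ H ∣ + ∣ K ∪ L ∣ ≤ n
  ∣H∣+∣K∪L∣≤n = subst (_≤ n) (+-comm ∣ K ∪ L ∣ ∣ H ∣)
    (disjointᵇ⇒∣p∣+∣q∣≤n (K ∪ L) H (trans (disjointᵇ-∪ K L H) (cong₂ _∧_ K∩H≡∅ L∩H≡∅)))
  t≤∣K∩L∣ : t ≤ ∣ K ∩ L ∣
  t≤∣K∩L∣ = +-cancelˡ-≤ (∣ H ∣ + ∣ K ∪ L ∣) t ∣ K ∩ L ∣ (begin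
    ∣ H ∣ + ∣ K ∪ L ∣ + t          ≤⟨ +-monoˡ-≤ t ∣H∣+∣K∪L∣≤n ⟩
    n + t                          ≤⟨ bound ⟩
    ∣ H ∣ + ∣ K ∣ + ∣ L ∣            ≡⟨ +-assoc ∣ H ∣ _ _ ⟩
    ∣ H ∣ + (∣ K ∣ + ∣ L ∣)          ≡⟨ cong (∣ H ∣ +_) (∣p∪q∣+∣p∩q∣≡∣p∣+∣q∣ K L) ⟨
    ∣ H ∣ + (∣ K ∪ L ∣ + ∣ K ∩ L ∣)  ≡⟨ +-assoc ∣ H ∣ _ _ ⟨
    ∣ H ∣ + ∣ K ∪ L ∣ + ∣ K ∩ L ∣    ∎)

-- Packings and informative announcements

Uniform : ∀ {n} → ℕ → Family n → Set
Uniform k B = ∀ K → B K ≡ true → ∣ K ∣ ≡ k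

blocksContaining : ∀ {n} → Family n → Subset n → ℕ
blocksContaining B T = countS (λ K → B K ∧ ⊆ᵇ T K)

Packing : ∀ {n} → ℕ → Family n → Set
Packing t B = ∀ T → ∣ T ∣ ≡ t → blocksContaining B T ≤ 1

InformativeAnnouncement : ∀ {n} → ℕ → Family n → Set
InformativeAnnouncement b B = ∀ H → ∣ H ∣ ≡ b → countS (λ K → B K ∧ disjointᵇ K H) ≤ 1

module _ {n a b t} {B : Family n} (n+t≡b+a+a : n + t ≡ b + a + a) (uniform : Uniform a B) where

  packing⇒informative : Packing t B → InformativeAnnouncement b B
  packing⇒informative packing H ∣H∣≡b = AtMostOne⇒countS≤1 _ same-block
    where
    same-block : AtMostOne (λ K → B K ∧ disjointᵇ K H)
    same-block {K} {L} K∈B∖H L∈B∖H =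
      let K∈B , K∩H≡∅ = ∧≡true⇒ K∈B∖H
          L∈B , L∩H≡∅ = ∧≡true⇒ L∈B∖H
          bound = ≤-reflexive (trans n+t≡b+a+a
                    (cong₂ _+_ (cong₂ _+_ (sym ∣H∣≡b) (sym (uniform K K∈B))) (sym (uniform L L∈B))))
          T , ∣T∣≡t , T⊆K , T⊆L = common-avoider⇒common-subset t K L H K∩H≡∅ L∩H≡∅ bound
      in countS≤1⇒AtMostOne _ (packing T ∣T∣≡t) (cong₂ _∧_ K∈B T⊆K) (cong₂ _∧_ L∈B T⊆L)

  informative⇒packing : InformativeAnnouncement b B → Packing t B
  informative⇒packing informative T ∣T∣≡t = AtMostOne⇒countS≤1 _ same-block
    where
    same-block : AtMostOne (λ K → B K ∧ ⊆ᵇ T K)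
    same-block {K} {L} K∈B∋T L∈B∋T =
      let K∈B , T⊆K = ∧≡true⇒ K∈B∋T
          L∈B , T⊆L = ∧≡true⇒ L∈B∋T
          bound = ≤-reflexive (trans (cong₂ _+_ (cong (b +_) (uniform K K∈B)) (uniform L L∈B))
                    (trans (sym n+t≡b+a+a) (cong (n +_) (sym ∣T∣≡t))))
          H , ∣H∣≡b , K∩H≡∅ , L∩H≡∅ = common-subset⇒common-avoider b K L T T⊆K T⊆L bound
      in countS≤1⇒AtMostOne _ (informative H ∣H∣≡b) (cong₂ _∧_ K∈B K∩H≡∅) (cong₂ _∧_ L∈B L∩H≡∅)

-- Double counting

countS-⊆-sized : ∀ {n} (K : Subset n) t → countS (λ T → ⊆ᵇ T K ∧ (∣ T ∣ ≡ᵇ t)) ≡ ∣ K ∣ C t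
countS-⊆-sized []            zero    = refl
countS-⊆-sized []            (suc t) = refl
countS-⊆-sized {suc n} (outside ∷ K) t =
  trans (cong₂ _+_ (countS-⊆-sized K t) (countS-false n)) (+-identityʳ _)
countS-⊆-sized {suc n} (inside ∷ K) zero =
  cong₂ _+_ (countS-⊆-sized K zero) (trans (countS-cong {n} λ T → ∧-zeroʳ (⊆ᵇ T K)) (countS-false n))
countS-⊆-sized (inside ∷ K)  (suc t) =
  trans (cong₂ _+_ (countS-⊆-sized K (suc t)) (countS-⊆-sized K t))
        (trans (+-comm (∣ K ∣ C suc t) _) (nCk+nC[k+1]≡[n+1]C[k+1] ∣ K ∣ t))

∑χ-sized : ∀ n t → ∑[ T ∈ subsets n ] χ (∣ T ∣ ≡ᵇ t) ≡ n C t
∑χ-sized n t = begin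
  ∑[ T ∈ subsets n ] χ (∣ T ∣ ≡ᵇ t)          ≡⟨ countS≡∑χ {n} (λ T → ∣ T ∣ ≡ᵇ t) ⟨
  countS {n} (λ T → ∣ T ∣ ≡ᵇ t)              ≡⟨ countS-cong {n} (λ T → cong (_∧ (∣ T ∣ ≡ᵇ t)) (⊆ᵇ-⊤ T)) ⟨
  countS {n} (λ T → ⊆ᵇ T ⊤ ∧ (∣ T ∣ ≡ᵇ t))   ≡⟨ countS-⊆-sized (⊤ {n}) t ⟩
  ∣ ⊤ {n} ∣ C t                               ≡⟨ cong (_C t) (∣⊤∣≡n n) ⟩
  n C t                                       ∎
  where open ≡-Reasoning

module _ {n k} {B : Family n} (uniform : Uniform k B) where

  ∑-blocksContaining : ∀ t →
    ∑[ T ∈ subsets n ] χ (∣ T ∣ ≡ᵇ t) * blocksContaining B T ≡ (k C t) * countS B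
  ∑-blocksContaining t = begin
    ∑[ T ∈ Ts ] χ (∣ T ∣ ≡ᵇ t) * countS (λ K → B K ∧ ⊆ᵇ T K)
      ≡⟨ ∑-cong Ts (λ T → trans (cong (χ (∣ T ∣ ≡ᵇ t) *_) (countS≡∑χ (λ K → B K ∧ ⊆ᵇ T K)))
                                (*-distribˡ-∑ (χ (∣ T ∣ ≡ᵇ t)) (λ K → χ (B K ∧ ⊆ᵇ T K)) Ts)) ⟩
    ∑[ T ∈ Ts ] ∑[ K ∈ Ts ] χ (∣ T ∣ ≡ᵇ t) * χ (B K ∧ ⊆ᵇ T K)
      ≡⟨ ∑-comm _ Ts Ts ⟩
    ∑[ K ∈ Ts ] ∑[ T ∈ Ts ] χ (∣ T ∣ ≡ᵇ t) * χ (B K ∧ ⊆ᵇ T K)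
      ≡⟨ ∑-cong Ts (λ K → ∑-cong Ts (λ T → χ-rotate (∣ T ∣ ≡ᵇ t) (B K) (⊆ᵇ T K))) ⟩
    ∑[ K ∈ Ts ] ∑[ T ∈ Ts ] χ (B K) * χ (⊆ᵇ T K ∧ (∣ T ∣ ≡ᵇ t))
      ≡⟨ ∑-cong Ts (λ K → trans (cong (χ (B K) *_) (countS≡∑χ (λ T → ⊆ᵇ T K ∧ (∣ T ∣ ≡ᵇ t))))
                                (*-distribˡ-∑ (χ (B K)) (λ T → χ (⊆ᵇ T K ∧ (∣ T ∣ ≡ᵇ t))) Ts)) ⟨
    ∑[ K ∈ Ts ] χ (B K) * countS (λ T → ⊆ᵇ T K ∧ (∣ T ∣ ≡ᵇ t))
      ≡⟨ ∑-cong Ts (λ K → trans (cong (χ (B K) *_) (countS-⊆-sized K t)) (block-weight K)) ⟩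
    ∑[ K ∈ Ts ] (k C t) * χ (B K)
      ≡⟨ trans (cong ((k C t) *_) (countS≡∑χ B)) (*-distribˡ-∑ (k C t) (χ ∘ B) Ts) ⟨
    (k C t) * countS B
      ∎
    where
    open ≡-Reasoning
    Ts : List (Subset n)
    Ts = subsets n
    χ-rotate : ∀ s b u → χ s * χ (b ∧ u) ≡ χ b * χ (u ∧ s)
    χ-rotate s b u = begin
      χ s * χ (b ∧ u)     ≡⟨ cong (χ s *_) (χ-∧ b u) ⟩
      χ s * (χ b * χ u)   ≡⟨ *-CS.x∙yz≈y∙zx (χ s) (χ b) (χ u) ⟩
      χ b * (χ u * χ s)   ≡⟨ cong (χ b *_) (χ-∧ u s) ⟨
      χ b * χ (u ∧ s)     ∎
    block-weight : ∀ K → χ (B K) * (∣ K ∣ C t) ≡ (k C t) * χ (B K)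
    block-weight K with B K in K∈B
    ... | true  = trans (*-comm 1 _) (cong (λ m → (m C t) * 1) (uniform K K∈B))
    ... | false = sym (*-zeroʳ (k C t))

  design⇒blockCount : ∀ {t r} → (∀ T → ∣ T ∣ ≡ t → blocksContaining B T ≡ r) →
    (k C t) * countS B ≡ r * (n C t)
  design⇒blockCount {t} {r} regular = begin
    (k C t) * countS B                                 ≡⟨ ∑-blocksContaining t ⟨
    ∑[ T ∈ Ts ] χ (∣ T ∣ ≡ᵇ t) * blocksContaining B T  ≡⟨ ∑-cong Ts weight ⟩
    ∑[ T ∈ Ts ] r * χ (∣ T ∣ ≡ᵇ t)                     ≡⟨ *-distribˡ-∑ r (λ T → χ (∣ T ∣ ≡ᵇ t)) Ts ⟨
    r * (∑[ T ∈ Ts ] χ (∣ T ∣ ≡ᵇ t))                   ≡⟨ cong (r *_) (∑χ-sized n t) ⟩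
    r * (n C t)                                        ∎
    where
    open ≡-Reasoning
    Ts : List (Subset n)
    Ts = subsets n
    weight : ∀ T → χ (∣ T ∣ ≡ᵇ t) * blocksContaining B T ≡ r * χ (∣ T ∣ ≡ᵇ t)
    weight T with ∣ T ∣ ≡ᵇ t in ∣T∣≡ᵇt
    ... | true  = trans (*-identityˡ _) (trans (regular T (≡ᵇ-true⇒≡ ∣T∣≡ᵇt)) (sym (*-identityʳ r)))
    ... | false = sym (*-zeroʳ r)

  module _ {t} (packing : Packing t B) where

    private
      weight≤ : ∀ T → χ (∣ T ∣ ≡ᵇ t) * blocksContaining B T ≤ χ (∣ T ∣ ≡ᵇ t)
      weight≤ T with ∣ T ∣ ≡ᵇ t in ∣T∣≡ᵇt
      ... | true  = subst (_≤ 1) (sym (*-identityˡ _)) (packing T (≡ᵇ-true⇒≡ ∣T∣≡ᵇt))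
      ... | false = z≤n

    packing-bound : (k C t) * countS B ≤ n C t
    packing-bound = subst₂ _≤_ (∑-blocksContaining t) (∑χ-sized n t) (∑-mono-≤ (subsets n) weight≤)

    packing-tight : n C t ≤ (k C t) * countS B → ∀ T → ∣ T ∣ ≡ t → blocksContaining B T ≡ 1
    packing-tight nCt≤ T ∣T∣≡t =
      trans (sym (*-identityˡ _)) (subst (λ s → χ s * blocksContaining B T ≡ χ s) (≡⇒≡ᵇ-true ∣T∣≡t) tight)
      where
      tight : χ (∣ T ∣ ≡ᵇ t) * blocksContaining B T ≡ χ (∣ T ∣ ≡ᵇ t)
      tight = ∑-mono-≤-tight (subsets n) weight≤
                (subst₂ _≤_ (sym (∑χ-sized n t)) (sym (∑-blocksContaining t)) nCt≤) (∈-subsets T)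

nCk*[k!*[n∸k]!]≡n! : ∀ {n k} → k ≤ n → (n C k) * (k ! * (n ∸ k) !) ≡ n !
nCk*[k!*[n∸k]!]≡n! {n} {k} k≤n =
  trans (cong (_* (k ! * (n ∸ k) !)) (nCk≡n!/k![n-k]! k≤n)) (m/n*n≡m {{k !* (n ∸ k) !≢0}} (k![n∸k]!∣n! k≤n))

nCk-nonZero : ∀ {n k} → k ≤ n → NonZero (n C k)
nCk-nonZero {n} {k} k≤n = m*n≢0⇒m≢0 (n C k) {{subst NonZero (sym (nCk*[k!*[n∸k]!]≡n! k≤n)) (n !≢0)}}

nCk*kCj≡nCj*[n∸j]C[k∸j] : ∀ {n k j} → j ≤ k → k ≤ n → (n C k) * (k C j) ≡ (n C j) * ((n ∸ j) C (k ∸ j))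
nCk*kCj≡nCj*[n∸j]C[k∸j] {n} {k} {j} j≤k k≤n =
  *-cancelʳ-≡ _ _ F {{m*n≢0 _ _ {{j !≢0}} {{(k ∸ j) !* (n ∸ k) !≢0}}}} (trans lhs*F≡n! (sym rhs*F≡n!))
  where
  open ≡-Reasoning
  F : ℕ
  F = j ! * ((k ∸ j) ! * (n ∸ k) !)
  regroupₗ : ∀ x y u v w → x * y * (u * (v * w)) ≡ x * (y * (u * v) * w)
  regroupₗ = solve-∀
  regroupᵣ : ∀ x y u v w → x * y * (u * (v * w)) ≡ x * (u * (y * (v * w)))
  regroupᵣ = solve-∀
  lhs*F≡n! : (n C k) * (k C j) * F ≡ n !
  lhs*F≡n! = begin
    (n C k) * (k C j) * F                                   ≡⟨ regroupₗ (n C k) (k C j) (j !) ((k ∸ j) !) ((n ∸ k) !) ⟩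
    (n C k) * ((k C j) * (j ! * (k ∸ j) !) * (n ∸ k) !)     ≡⟨ cong (λ x → (n C k) * (x * (n ∸ k) !)) (nCk*[k!*[n∸k]!]≡n! j≤k) ⟩
    (n C k) * (k ! * (n ∸ k) !)                             ≡⟨ nCk*[k!*[n∸k]!]≡n! k≤n ⟩
    n !                                                     ∎
  [n∸j]∸[k∸j]≡n∸k : (n ∸ j) ∸ (k ∸ j) ≡ n ∸ k
  [n∸j]∸[k∸j]≡n∸k = trans (∸-+-assoc n j (k ∸ j)) (cong (n ∸_) (m+[n∸m]≡n j≤k))
  rhs*F≡n! : (n C j) * ((n ∸ j) C (k ∸ j)) * F ≡ n !
  rhs*F≡n! = begin
    (n C j) * ((n ∸ j) C (k ∸ j)) * F
      ≡⟨ regroupᵣ (n C j) ((n ∸ j) C (k ∸ j)) (j !) ((k ∸ j) !) ((n ∸ k) !) ⟩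
    (n C j) * (j ! * (((n ∸ j) C (k ∸ j)) * ((k ∸ j) ! * (n ∸ k) !)))
      ≡⟨ cong (λ x → (n C j) * (j ! * (((n ∸ j) C (k ∸ j)) * ((k ∸ j) ! * x !)))) [n∸j]∸[k∸j]≡n∸k ⟨
    (n C j) * (j ! * (((n ∸ j) C (k ∸ j)) * ((k ∸ j) ! * ((n ∸ j) ∸ (k ∸ j)) !)))
      ≡⟨ cong (λ x → (n C j) * (j ! * x)) (nCk*[k!*[n∸k]!]≡n! (∸-monoˡ-≤ j k≤n)) ⟩
    (n C j) * (j ! * (n ∸ j) !)
      ≡⟨ nCk*[k!*[n∸k]!]≡n! (≤-trans j≤k k≤n) ⟩
    n ! ∎

χℚ : Bool → ℚ
χℚ true  = 1ℚ
χℚ false = 0ℚ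

module _ (f : I → Bool) where

  private
    ∑χℚ : List I → ℚ
    ∑χℚ = foldr (λ x r → χℚ (f x) +ℚ r) 0ℚ

  ∑χ≡0⇒∑χℚ≡0 : ∀ xs → ∑[ x ∈ xs ] χ (f x) ≡ 0 → ∑χℚ xs ≡ 0ℚ
  ∑χ≡0⇒∑χℚ≡0 []       _    = refl
  ∑χ≡0⇒∑χℚ≡0 (x ∷ xs) ∑≡0 with f x
  ... | false = trans (ℚ.+-identityˡ _) (∑χ≡0⇒∑χℚ≡0 xs ∑≡0)

  ∑χ≡1⇒∑χℚ≡1 : ∀ xs → ∑[ x ∈ xs ] χ (f x) ≡ 1 → ∑χℚ xs ≡ 1ℚ
  ∑χ≡1⇒∑χℚ≡1 (x ∷ xs) ∑≡1 with f x
  ... | true  = trans (cong (1ℚ +ℚ_) (∑χ≡0⇒∑χℚ≡0 xs (suc-injective ∑≡1))) (ℚ.+-identityʳ 1ℚ)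
  ... | false = trans (ℚ.+-identityˡ _) (∑χ≡1⇒∑χℚ≡1 xs ∑≡1)

∑-allFin-const : ∀ m k → ∑[ i ∈ allFin m ] k ≡ m * k
∑-allFin-const m k = trans (∑-const k (allFin m)) (cong (_* k) (length-tabulate {n = m} id))

countFin≡∑χ : ∀ {m} (f : Fin m → Bool) → countFin f ≡ ∑[ i ∈ allFin m ] χ (f i)
countFin≡∑χ {m} f = go (allFin m)
  where
  go : ∀ is → foldr (λ i r → if f i then suc r else r) 0 is ≡ ∑[ i ∈ is ] χ (f i)
  go []       = refl
  go (i ∷ is) with f i
  ... | true  = cong suc (go is)
  ... | false = go is

∑-countS≡∑-countFin : ∀ {m n} (A : Fin m → Family n) →
  ∑[ i ∈ allFin m ] countS (A i) ≡ ∑[ K ∈ subsets n ] countFin (λ i → A i K)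
∑-countS≡∑-countFin {m} {n} A = begin
  ∑[ i ∈ allFin m ] countS (A i)                    ≡⟨ ∑-cong (allFin m) (λ i → countS≡∑χ (A i)) ⟩
  ∑[ i ∈ allFin m ] ∑[ K ∈ subsets n ] χ (A i K)    ≡⟨ ∑-comm (λ i K → χ (A i K)) (allFin m) (subsets n) ⟩
  ∑[ K ∈ subsets n ] ∑[ i ∈ allFin m ] χ (A i K)    ≡⟨ ∑-cong (subsets n) (λ K → countFin≡∑χ (λ i → A i K)) ⟨
  ∑[ K ∈ subsets n ] countFin (λ i → A i K)         ∎
  where open ≡-Reasoning

-- Large sets give optimal informative strategies

design-uniform : ∀ {t v k r B} → IsDesign t v k r B → Uniform k B
design-uniform (_ , _ , _ , uniform , _) = uniform

design-regular : ∀ {t v k r B} → IsDesign t v k r B → ∀ T → ∣ T ∣ ≡ t → blocksContaining B T ≡ r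
design-regular (_ , _ , _ , _ , regular) = regular

module _ {n a t N} {A : Fin N → Family n} (largeSet : IsLargeSet t n a N A) where

  private
    designs : ∀ i → IsDesign t n a 1 (A i)
    designs = proj₁ largeSet
    exactlyOne : ∀ K → ∣ K ∣ ≡ a → countFin (λ i → A i K) ≡ 1
    exactlyOne = proj₂ largeSet

  largeSet⇒strategy : Σ (Subset n → Fin N → ℚ) (IsStrategy n a N A)
  largeSet⇒strategy = p , design-uniform ∘ designs , covering , distribution
    where
    p : Subset n → Fin N → ℚ
    p H i = χℚ (A i H)
    ∑χ≡1 : ∀ H → ∣ H ∣ ≡ a → ∑[ i ∈ allFin N ] χ (A i H) ≡ 1
    ∑χ≡1 H ∣H∣≡a = trans (sym (countFin≡∑χ (λ i → A i H))) (exactlyOne H ∣H∣≡a)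
    covering : ∀ H → ∣ H ∣ ≡ a → ∃ λ i → A i H ≡ true
    covering H ∣H∣≡a = ∑χ-witness (λ i → A i H) (allFin N) (≤-reflexive (sym (∑χ≡1 H ∣H∣≡a)))
    p-support : ∀ H i → (A i H ≡ true → 0ℚ <ℚ p H i) × (A i H ≡ false → p H i ≡ 0ℚ)
    p-support H i with A i H
    ... | true  = (λ _ → ℚ.positive⁻¹ 1ℚ) , λ ()
    ... | false = (λ ()) , λ _ → refl
    distribution : ∀ H → ∣ H ∣ ≡ a →
      (∀ i → (A i H ≡ true → 0ℚ <ℚ p H i) × (A i H ≡ false → p H i ≡ 0ℚ)) × sumℚ (p H) ≡ 1ℚ
    distribution H ∣H∣≡a = p-support H , ∑χ≡1⇒∑χℚ≡1 (λ i → A i H) (allFin N) (∑χ≡1 H ∣H∣≡a)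

  largeSet⇒informative : ∀ {b} → n + t ≡ b + a + a → InformativeForBob n b N A
  largeSet⇒informative n+t≡b+a+a H ∣H∣≡b i =
    packing⇒informative n+t≡b+a+a (design-uniform (designs i))
      (λ T ∣T∣≡t → ≤-reflexive (design-regular (designs i) T ∣T∣≡t)) H ∣H∣≡b

  private
    largeSet-countFin : ∀ K → countFin (λ i → A i K) ≡ χ (∣ K ∣ ≡ᵇ a)
    largeSet-countFin K with ∣ K ∣ ≡ᵇ a in ∣K∣≡ᵇa
    ... | true  = exactlyOne K (≡ᵇ-true⇒≡ ∣K∣≡ᵇa)
    ... | false = begin
      countFin (λ i → A i K)            ≡⟨ countFin≡∑χ (λ i → A i K) ⟩
      ∑[ i ∈ allFin N ] χ (A i K)       ≡⟨ ∑-cong (allFin N) (λ i → cong χ (K∉A i)) ⟩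
      ∑[ i ∈ allFin N ] 0               ≡⟨ ∑-zero (allFin N) ⟩
      0                                 ∎
      where
      open ≡-Reasoning
      K∉A : ∀ i → A i K ≡ false
      K∉A i with A i K in K∈A
      ... | false = refl
      ... | true  with () ← trans (sym (≡⇒≡ᵇ-true (design-uniform (designs i) K K∈A))) ∣K∣≡ᵇa

  largeSet-size : t ≤ a → a ≤ n → N ≡ (n ∸ t) C (a ∸ t)
  largeSet-size t≤a a≤n = *-cancelˡ-≡ N _ (n C t) {{nCk-nonZero (≤-trans t≤a a≤n)}} (begin
    (n C t) * N                                  ≡⟨ *-comm (n C t) N ⟩
    N * (n C t)                                  ≡⟨ ∑-allFin-const N (n C t) ⟨
    ∑[ i ∈ allFin N ] (n C t)                    ≡⟨ ∑-cong (allFin N) blocks ⟨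
    ∑[ i ∈ allFin N ] (a C t) * countS (A i)     ≡⟨ *-distribˡ-∑ (a C t) (countS ∘ A) (allFin N) ⟨
    (a C t) * (∑[ i ∈ allFin N ] countS (A i))   ≡⟨ cong ((a C t) *_) total ⟩
    (a C t) * (n C a)                            ≡⟨ *-comm (a C t) (n C a) ⟩
    (n C a) * (a C t)                            ≡⟨ nCk*kCj≡nCj*[n∸j]C[k∸j] t≤a a≤n ⟩
    (n C t) * ((n ∸ t) C (a ∸ t))                ∎)
    where
    open ≡-Reasoning
    blocks : ∀ i → (a C t) * countS (A i) ≡ n C t
    blocks i = trans (design⇒blockCount (design-uniform (designs i)) (design-regular (designs i)))
                     (*-identityˡ (n C t))
    total : ∑[ i ∈ allFin N ] countS (A i) ≡ n C a
    total = begin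
      ∑[ i ∈ allFin N ] countS (A i)              ≡⟨ ∑-countS≡∑-countFin A ⟩
      ∑[ K ∈ subsets n ] countFin (λ i → A i K)   ≡⟨ ∑-cong (subsets n) largeSet-countFin ⟩
      ∑[ K ∈ subsets n ] χ (∣ K ∣ ≡ᵇ a)          ≡⟨ ∑χ-sized n a ⟩
      n C a                                       ∎

-- Optimal informative strategies give large sets

module _ {n a b t m} {A : Fin m → Family n} {p : Subset n → Fin m → ℚ}
         (1≤t : 1 ≤ t) (t≤a : t ≤ a) (a<n : a < n) (n+t≡b+a+a : n + t ≡ b + a + a)
         (strategy : IsStrategy n a m A p) (informative : InformativeForBob n b m A)
         (m≡[n∸t]C[a∸t] : m ≡ (n ∸ t) C (a ∸ t)) where

  private
    uniform : ∀ i → Uniform a (A i)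
    uniform = proj₁ strategy
    covering : ∀ H → ∣ H ∣ ≡ a → ∃ λ i → A i H ≡ true
    covering = proj₁ (proj₂ strategy)
    a≤n : a ≤ n
    a≤n = <⇒≤ a<n
    instance
      aCt≢0 : NonZero (a C t)
      aCt≢0 = nCk-nonZero t≤a

    packings : ∀ i → Packing t (A i)
    packings i = informative⇒packing n+t≡b+a+a (uniform i) (λ H ∣H∣≡b → informative H ∣H∣≡b i)

    total : ℕ
    total = ∑[ i ∈ allFin m ] countS (A i)

    m*nCt≡aCt*nCa : m * (n C t) ≡ (a C t) * (n C a)
    m*nCt≡aCt*nCa = begin
      m * (n C t)                     ≡⟨ cong (_* (n C t)) m≡[n∸t]C[a∸t] ⟩
      ((n ∸ t) C (a ∸ t)) * (n C t)   ≡⟨ *-comm _ (n C t) ⟩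
      (n C t) * ((n ∸ t) C (a ∸ t))   ≡⟨ nCk*kCj≡nCj*[n∸j]C[k∸j] t≤a a≤n ⟨
      (n C a) * (a C t)               ≡⟨ *-comm (n C a) (a C t) ⟩
      (a C t) * (n C a)               ∎
      where open ≡-Reasoning

    aCt*total≡∑ : (a C t) * total ≡ ∑[ i ∈ allFin m ] (a C t) * countS (A i)
    aCt*total≡∑ = *-distribˡ-∑ (a C t) (countS ∘ A) (allFin m)

    covered : ∀ K → χ (∣ K ∣ ≡ᵇ a) ≤ countFin (λ i → A i K)
    covered K with ∣ K ∣ ≡ᵇ a in ∣K∣≡ᵇa
    ... | false = z≤n
    ... | true  = let i , K∈Aᵢ = covering K (≡ᵇ-true⇒≡ ∣K∣≡ᵇa) in
      subst (1 ≤_) (sym (countFin≡∑χ (λ i → A i K)))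
        (subst (λ x → χ x ≤ ∑[ j ∈ allFin m ] χ (A j K)) K∈Aᵢ (∈⇒≤∑ (λ j → χ (A j K)) (∈-allFin i)))

    nCa≤total : n C a ≤ total
    nCa≤total = subst₂ _≤_ (∑χ-sized n a) (sym (∑-countS≡∑-countFin A)) (∑-mono-≤ (subsets n) covered)

    total≤nCa : total ≤ n C a
    total≤nCa = *-cancelˡ-≤ (a C t) (begin
      (a C t) * total                                ≡⟨ aCt*total≡∑ ⟩
      ∑[ i ∈ allFin m ] (a C t) * countS (A i)       ≤⟨ ∑-mono-≤ (allFin m) (λ i → packing-bound (uniform i) (packings i)) ⟩
      ∑[ i ∈ allFin m ] (n C t)                      ≡⟨ ∑-allFin-const m (n C t) ⟩
      m * (n C t)                                    ≡⟨ m*nCt≡aCt*nCa ⟩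
      (a C t) * (n C a)                              ∎)
      where open ≤-Reasoning

    strategy⇒designs : ∀ i → IsDesign t n a 1 (A i)
    strategy⇒designs i = 1≤t , t≤a , a<n , uniform i , packing-tight (uniform i) (packings i) nCt≤
      where
      open ≤-Reasoning
      ∑nCt≤∑ : ∑[ j ∈ allFin m ] (n C t) ≤ ∑[ j ∈ allFin m ] (a C t) * countS (A j)
      ∑nCt≤∑ = begin
        ∑[ j ∈ allFin m ] (n C t)                  ≡⟨ trans (∑-allFin-const m (n C t)) m*nCt≡aCt*nCa ⟩
        (a C t) * (n C a)                          ≤⟨ *-monoʳ-≤ (a C t) nCa≤total ⟩
        (a C t) * total                            ≡⟨ aCt*total≡∑ ⟩
        ∑[ j ∈ allFin m ] (a C t) * countS (A j)   ∎
      nCt≤ : n C t ≤ (a C t) * countS (A i)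
      nCt≤ = ≤-reflexive (sym (∑-mono-≤-tight (allFin m) (λ j → packing-bound (uniform j) (packings j))
                                 ∑nCt≤∑ (∈-allFin i)))

    strategy⇒exactlyOne : ∀ K → ∣ K ∣ ≡ a → countFin (λ i → A i K) ≡ 1
    strategy⇒exactlyOne K ∣K∣≡a =
      subst (λ x → countFin (λ i → A i K) ≡ χ x) (≡⇒≡ᵇ-true ∣K∣≡a)
        (sym (∑-mono-≤-tight (subsets n) covered
                (subst₂ _≤_ (∑-countS≡∑-countFin A) (sym (∑χ-sized n a)) total≤nCa) (∈-subsets K)))

  informativeStrategy⇒largeSet : IsLargeSet t n a m A
  informativeStrategy⇒largeSet = strategy⇒designs , strategy⇒exactlyOne

theorem3 : (n a b c : ℕ) → 1 ≤ a → 1 ≤ b → 1 ≤ c → a + b + c ≡ n → c < a →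
    ((N : ℕ) (A : Fin N → Family n) → IsLargeSet (a ∸ c) n a N A →
      Σ (Subset n → Fin N → ℚ) (λ p → IsStrategy n a N A p)
      × InformativeForBob n b N A
      × N ≡ (n ∸ a + c) C c)
    × ((m : ℕ) (A : Fin m → Family n) (p : Subset n → Fin m → ℚ) →
      IsStrategy n a m A p → InformativeForBob n b m A → m ≡ (n ∸ a + c) C c →
      (∀ i → IsDesign (a ∸ c) n a 1 (A i)) × IsLargeSet (a ∸ c) n a m A)
theorem3 n a b c _ 1≤b _ a+b+c≡n c<a =
  (λ N A largeSet →
     largeSet⇒strategy largeSet ,
     largeSet⇒informative largeSet n+t≡b+a+a ,
     trans (largeSet-size largeSet t≤a a≤n) optimal-count) ,
  (λ m A p strategy informative m≡ →
     let largeSet = informativeStrategy⇒largeSet 1≤t t≤a a<n n+t≡b+a+a strategy informative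
                      (trans m≡ (sym optimal-count))
     in proj₁ largeSet , largeSet)
  where
  open ≡-Reasoning
  t : ℕ
  t = a ∸ c
  c≤a : c ≤ a
  c≤a = <⇒≤ c<a
  1≤t : 1 ≤ t
  1≤t = m<n⇒0<n∸m c<a
  t≤a : t ≤ a
  t≤a = m∸n≤m a c
  a<n : a < n
  a<n = subst (a <_) a+b+c≡n (<-≤-trans (m<m+n a 1≤b) (m≤m+n (a + b) c))
  a≤n : a ≤ n
  a≤n = <⇒≤ a<n
  n+t≡b+a+a : n + t ≡ b + a + a
  n+t≡b+a+a = begin
    n + t             ≡⟨ cong (_+ t) a+b+c≡n ⟨
    a + b + c + t     ≡⟨ regroup a b c t ⟩
    b + a + (t + c)   ≡⟨ cong (b + a +_) (m∸n+n≡m c≤a) ⟩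
    b + a + a         ∎
    where
    regroup : ∀ a b c t → a + b + c + t ≡ b + a + (t + c)
    regroup = solve-∀
  optimal-count : (n ∸ t) C (a ∸ t) ≡ (n ∸ a + c) C c
  optimal-count = cong₂ _C_ n∸t≡n∸a+c (m∸[m∸n]≡n c≤a)
    where
    n∸t≡n∸a+c : n ∸ t ≡ n ∸ a + c
    n∸t≡n∸a+c = begin
      n ∸ t             ≡⟨ cong (_∸ t) (m∸n+n≡m a≤n) ⟨
      n ∸ a + a ∸ t     ≡⟨ +-∸-assoc (n ∸ a) t≤a ⟩
      n ∸ a + (a ∸ t)   ≡⟨ cong (n ∸ a +_) (m∸[m∸n]≡n c≤a) ⟩
      n ∸ a + c         ∎
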